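{- For every positive integer $n\neq 1,3$, there exists a connected graph $G$ of order $n$ with $\chi_d^t(C(G))=n$.
   Context: All graphs are finite, simple and undirected. For a graph $G=(V,E)$ with $V=\{v_1,\dots,v_n\}$, the central graph $C(G)$ is the graph with vertex set $V\cup\{c_{ij} : v_iv_j\in E\}$ obtained by subdividing each edge $v_iv_j$ of $G$ exactly once by a new vertex $c_{ij}$ (adjacent to exactly $v_i$ and $v_j$) and joining every pair of distinct vertices non-adjacent in $G$. A total dominator coloring (TDC) of a graph $H$ with no isolated vertices is a proper vertex coloring of $H$ in which every vertex is adjacent to all vertices of some color class. $\chi_d^t(H)$ is the minimum number of color classes in a TDC of $H$. -}

module Defs where

open import Data.Nat using (ℕ; _<_)
open import Data.Fin as Fin using (Fin)
open import Data.Bool using (Bool; true; false)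
open import Data.Product using (Σ; _×_; _,_; ∃)
open import Data.Sum using (_⊎_; inj₁; inj₂)
open import Data.Empty using (⊥)
open import Relation.Binary.PropositionalEquality using (_≡_; _≢_)
open import Relation.Nullary using (¬_)
open import Function.Definitions using (Surjective)

record FinGraph (n : ℕ) : Set where
  field
    adj     : Fin n → Fin n → Bool
    adj-sym : ∀ i j → adj i j ≡ adj j i
    adj-irr : ∀ i → adj i i ≡ false
open FinGraph public

data Walk {n : ℕ} (G : FinGraph n) : Fin n → Fin n → Set where
  here : ∀ {u} → Walk G u u
  step : ∀ {u v w} → adj G u v ≡ true → Walk G v w → Walk G u w

Connected : {n : ℕ} → FinGraph n → Set
Connected G = ∀ u v → Walk G u v

-- Edges of G: each edge {v_i,v_j} appears once, as the pair (i , j) with i < j.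
Edge : {n : ℕ} → FinGraph n → Set
Edge {n} G = Σ (Fin n × Fin n) (λ { (i , j) → (i Fin.< j) × (adj G i j ≡ true) })

record Graph (V : Set) : Set₁ where
  field
    Adj     : V → V → Set
    Adj-sym : ∀ {x y} → Adj x y → Adj y x
    Adj-irr : ∀ {x} → ¬ Adj x x
open Graph public

CVertex : {n : ℕ} → FinGraph n → Set
CVertex {n} G = Fin n ⊎ Edge G

CAdj : {n : ℕ} (G : FinGraph n) → CVertex G → CVertex G → Set
CAdj G (inj₁ u) (inj₁ v) = (u ≢ v) × (adj G u v ≡ false)
CAdj G (inj₁ u) (inj₂ ((i , j) , _)) = (u ≡ i) ⊎ (u ≡ j)
CAdj G (inj₂ ((i , j) , _)) (inj₁ u) = (u ≡ i) ⊎ (u ≡ j)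
CAdj G (inj₂ _) (inj₂ _) = ⊥

CAdj-sym : {n : ℕ} (G : FinGraph n) {x y : CVertex G} → CAdj G x y → CAdj G y x
CAdj-sym G {inj₁ u} {inj₁ v} (u≢v , e) = (λ p → u≢v (Relation.Binary.PropositionalEquality.sym p)) ,
  Relation.Binary.PropositionalEquality.trans (adj-sym G v u) e
CAdj-sym G {inj₁ u} {inj₂ _} p = p
CAdj-sym G {inj₂ _} {inj₁ u} p = p
CAdj-sym G {inj₂ _} {inj₂ _} ()

CAdj-irr : {n : ℕ} (G : FinGraph n) {x : CVertex G} → ¬ CAdj G x x
CAdj-irr G {inj₁ u} (u≢u , _) = u≢u Relation.Binary.PropositionalEquality.refl
CAdj-irr G {inj₂ _} ()

Central : {n : ℕ} (G : FinGraph n) → Graph (CVertex G)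
Central G = record { Adj = CAdj G ; Adj-sym = CAdj-sym G ; Adj-irr = CAdj-irr G }

-- Total dominator coloring with exactly k color classes: a surjective
-- (so all k classes nonempty) proper coloring c : V → Fin k such that every
-- vertex is adjacent to all vertices of some color class.
IsTDC : {V : Set} (H : Graph V) (k : ℕ) → (V → Fin k) → Set
IsTDC {V} H k c =
  Surjective _≡_ _≡_ c
  × (∀ x y → Adj H x y → c x ≢ c y)
  × (∀ x → ∃ λ (j : Fin k) → ∀ y → c y ≡ j → Adj H x y)

HasTDC : {V : Set} (H : Graph V) (k : ℕ) → Set
HasTDC {V} H k = Σ (V → Fin k) (IsTDC H k)

TDCNumber≡ : {V : Set} (H : Graph V) (k : ℕ) → Set
TDCNumber≡ H k = HasTDC H k × (∀ m → m < k → ¬ HasTDC H m)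

-- Take the star K₁,ₙ₋₁. In its central graph the n − 1 leaves form a clique,
-- so a TDC needs at least n − 1 colours. With exactly n − 1 colours every
-- colour occurs on exactly one leaf; a subdivision vertex (spoke) c₀ₗ is adjacent to
-- only one leaf, so the class it dominates is the class of that leaf, and
-- choosing l so that this class also contains another subdivision vertex
-- gives a contradiction, since subdivision vertices are pairwise
-- non-adjacent. Conversely n colours suffice: all subdivision vertices form
-- one class and the centre shares the colour of a leaf. A leaf is then
-- dominated by the class of another leaf not sharing its colour with the centre,
-- which exists for n ≥ 4 (for n = 2, by the single spoke); n = 3 fails here.
module Submission where

open import Defs
open import Data.Nat using (ℕ; zero; suc; _+_; _<_; z≤n; s≤s; s≤s⁻¹)
open import Data.Nat.Properties using (n<1+n; ≤-antisym)
open import Data.Fin using (Fin; zero; suc; _≟_)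
open import Data.Fin.Properties using (pigeonhole; injective⇒≤; suc-injective; <⇒≢)
open import Data.Vec.Functional using (_∷_)
open import Data.Bool using (Bool; true; false)
open import Data.Product using (Σ; _×_; _,_; ∃; proj₁; proj₂)
open import Data.Sum using (inj₁; inj₂)
open import Function using (_∘_)
open import Function.Definitions using (Injective; Surjective; StrictlySurjective)
open import Relation.Nullary using (¬_; yes; no; contradiction)
open import Relation.Binary.PropositionalEquality
  using (_≡_; _≢_; refl; sym; trans; cong; module ≡-Reasoning)

injective⇒strictlySurjective : ∀ {n} {f : Fin n → Fin n} →
  Injective _≡_ _≡_ f → StrictlySurjective _≡_ f
injective⇒strictlySurjective {n} {f} f-inj k with pigeonhole (n<1+n n) (k ∷ f)
... | zero  , zero  , ()  , _
... | zero  , suc t , _   , k≡ft  = t , sym k≡ft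
... | suc _ , zero  , ()  , _
... | suc s , suc t , s<t , fs≡ft = contradiction (f-inj fs≡ft) (<⇒≢ (s≤s⁻¹ s<t))

module _ {V : Set} (H : Graph V) where

  Proper : ∀ {k} → (V → Fin k) → Set
  Proper c = ∀ x y → Adj H x y → c x ≢ c y

  Dominates : ∀ {k} → (V → Fin k) → V → Fin k → Set
  Dominates c x j = ∀ y → c y ≡ j → Adj H x y

  IsClique : ∀ {a} → (Fin a → V) → Set
  IsClique ι = ∀ {i j} → i ≢ j → Adj H (ι i) (ι j)

  proper∘clique-injective : ∀ {a k} {c : V → Fin k} {ι : Fin a → V} →
    Proper c → IsClique ι → Injective _≡_ _≡_ (c ∘ ι)
  proper∘clique-injective proper clique {i} {j} ci≡cj with i ≟ j
  ... | yes i≡j = i≡j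
  ... | no  i≢j = contradiction ci≡cj (proper _ _ (clique i≢j))

module Star (p : ℕ) where

  star-adj : Fin (suc (suc p)) → Fin (suc (suc p)) → Bool
  star-adj zero    zero    = false
  star-adj zero    (suc _) = true
  star-adj (suc _) zero    = true
  star-adj (suc _) (suc _) = false

  star-adj-sym : ∀ i j → star-adj i j ≡ star-adj j i
  star-adj-sym zero    zero    = refl
  star-adj-sym zero    (suc _) = refl
  star-adj-sym (suc _) zero    = refl
  star-adj-sym (suc _) (suc _) = refl

  star-adj-irr : ∀ i → star-adj i i ≡ false
  star-adj-irr zero    = refl
  star-adj-irr (suc _) = refl

  star : FinGraph (suc (suc p))
  star = record { adj = star-adj ; adj-sym = star-adj-sym ; adj-irr = star-adj-irr }

  star-connected : Connected star
  star-connected zero    zero    = here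
  star-connected zero    (suc _) = step refl here
  star-connected (suc _) zero    = step refl here
  star-connected (suc _) (suc _) = step {v = zero} refl (step refl here)

  C : Graph (CVertex star)
  C = Central star

  centre : CVertex star
  centre = inj₁ zero

  leaf : Fin (suc p) → CVertex star
  leaf t = inj₁ (suc t)

  spoke : Fin (suc p) → CVertex star
  spoke l = inj₂ ((zero , suc l) , s≤s z≤n , refl)

  leaves-clique : IsClique C leaf
  leaves-clique i≢j = (λ si≡sj → i≢j (suc-injective si≡sj)) , refl

  spoke-leaf-adjacent : ∀ {l j} → CAdj star (spoke l) (leaf j) → j ≡ l
  spoke-leaf-adjacent (inj₂ sj≡sl) = suc-injective sj≡sl

  edge-at-centre : (e : Edge star) → proj₁ (proj₁ e) ≡ zero
  edge-at-centre ((zero  , _)     , _  , _)  = refl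
  edge-at-centre ((suc _ , zero)  , () , _)
  edge-at-centre ((suc _ , suc _) , _  , ())

  no-TDC-leaf-many-colours : (c : CVertex star → Fin (suc p)) → Proper C c →
    ¬ (∀ x → ∃ (Dominates C c x))
  no-TDC-leaf-many-colours c proper dominated =
    dominates-k′ (spoke zero) c-spoke₀≡k′
    where
    onto : StrictlySurjective _≡_ (c ∘ leaf)
    onto = injective⇒strictlySurjective (proper∘clique-injective C proper leaves-clique)
    k  = c (spoke zero)
    l  = proj₁ (onto k)
    cl≡k = proj₂ (onto k)
    k′ = proj₁ (dominated (spoke l))
    dominates-k′ : Dominates C c (spoke l) k′
    dominates-k′ = proj₂ (dominated (spoke l))
    j  = proj₁ (onto k′)
    cj≡k′ = proj₂ (onto k′)
    j≡l : j ≡ l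
    j≡l = spoke-leaf-adjacent (dominates-k′ (leaf j) cj≡k′)
    c-spoke₀≡k′ : c (spoke zero) ≡ k′
    c-spoke₀≡k′ = begin
      c (spoke zero) ≡⟨ sym cl≡k ⟩
      c (leaf l)     ≡⟨ cong (c ∘ leaf) (sym j≡l) ⟩
      c (leaf j)     ≡⟨ cj≡k′ ⟩
      k′             ∎
      where open ≡-Reasoning

  no-TDC-below : ∀ m → m < suc (suc p) → ¬ HasTDC C m
  no-TDC-below m m<n (c , _ , proper , dominated)
    with ≤-antisym (s≤s⁻¹ m<n) (injective⇒≤ (proper∘clique-injective C proper leaves-clique))
  ... | refl = no-TDC-leaf-many-colours c proper dominated

  colouring : CVertex star → Fin (suc (suc p))
  colouring (inj₁ zero)    = suc zero
  colouring (inj₁ (suc t)) = suc t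
  colouring (inj₂ _)       = zero

  colouring-surjective : Surjective _≡_ _≡_ colouring
  colouring-surjective zero    = spoke zero , λ { refl → refl }
  colouring-surjective (suc t) = leaf t , λ { refl → refl }

  colouring-proper : Proper C colouring
  colouring-proper (inj₁ zero)    (inj₁ zero)    (u≢v , _)  = λ _ → u≢v refl
  colouring-proper (inj₁ zero)    (inj₁ (suc _)) (_ , ())
  colouring-proper (inj₁ (suc _)) (inj₁ zero)    (_ , ())
  colouring-proper (inj₁ (suc _)) (inj₁ (suc _)) (u≢v , _)  = u≢v
  colouring-proper (inj₁ zero)    (inj₂ _)       _          = λ ()
  colouring-proper (inj₁ (suc _)) (inj₂ _)       _          = λ ()
  colouring-proper (inj₂ _)       (inj₁ zero)    _          = λ ()
  colouring-proper (inj₂ _)       (inj₁ (suc _)) _          = λ ()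

  centre-dominates-spokes : Dominates C colouring centre zero
  centre-dominates-spokes (inj₁ zero)    ()
  centre-dominates-spokes (inj₁ (suc _)) ()
  centre-dominates-spokes (inj₂ e)       _  = inj₁ (sym (edge-at-centre e))

  spoke-dominates-its-leaf : ∀ l → Dominates C colouring (spoke l) (suc l)
  spoke-dominates-its-leaf l (inj₁ zero)    _     = inj₁ refl
  spoke-dominates-its-leaf l (inj₁ (suc _)) st≡sl = inj₂ st≡sl
  spoke-dominates-its-leaf l (inj₂ _)       ()

  spoke-dominated : (e : Edge star) → ∃ (Dominates C colouring (inj₂ e))
  spoke-dominated ((zero  , zero)  , () , _)
  spoke-dominated ((zero  , suc l) , s≤s z≤n , refl) = suc l , spoke-dominates-its-leaf l
  spoke-dominated ((suc _ , zero)  , () , _)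
  spoke-dominated ((suc _ , suc _) , _  , ())

  leaf-dominates-other-leaf : ∀ {s t} → s ≢ zero → s ≢ t → Dominates C colouring (leaf t) (suc s)
  leaf-dominates-other-leaf s≢0 _   (inj₁ zero)    s1≡ss = contradiction (sym (suc-injective s1≡ss)) s≢0
  leaf-dominates-other-leaf _   s≢t (inj₁ (suc u)) su≡ss =
    (λ st≡su → s≢t (sym (trans (suc-injective st≡su) (suc-injective su≡ss)))) , refl
  leaf-dominates-other-leaf _   _   (inj₂ _)       ()

  central-star-TDCNumber : (∀ t → ∃ (Dominates C colouring (leaf t))) →
    TDCNumber≡ C (suc (suc p))
  central-star-TDCNumber leaf-dominated =
    (colouring , colouring-surjective , colouring-proper , dominated) , no-TDC-below
    where
    dominated : ∀ x → ∃ (Dominates C colouring x)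
    dominated (inj₁ zero)    = zero , centre-dominates-spokes
    dominated (inj₁ (suc t)) = leaf-dominated t
    dominated (inj₂ e)       = spoke-dominated e

open Star

nonzero-avoiding : ∀ {q} (t : Fin (suc (suc (suc q)))) → ∃ λ s → s ≢ zero × s ≢ t
nonzero-avoiding zero          = suc zero , (λ ()) , (λ ())
nonzero-avoiding (suc zero)    = suc (suc zero) , (λ ()) , (λ ())
nonzero-avoiding (suc (suc _)) = suc zero , (λ ()) , (λ ())

leaves-dominated : ∀ p → p ≢ 1 → ∀ t → ∃ (Dominates (C p) (colouring p) (leaf p t))
leaves-dominated zero _ zero = zero , single-spoke
  where
  single-spoke : Dominates (C 0) (colouring 0) (leaf 0 zero) zero
  single-spoke (inj₁ zero)    ()
  single-spoke (inj₁ (suc _)) ()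
  single-spoke (inj₂ ((zero  , zero)     , () , _))  _
  single-spoke (inj₂ ((zero  , suc zero) , _))       _ = inj₂ refl
  single-spoke (inj₂ ((suc _ , zero)     , () , _))  _
  single-spoke (inj₂ ((suc _ , suc _)    , _  , ())) _
leaves-dominated (suc zero) p≢1 _ = contradiction refl p≢1
leaves-dominated (suc (suc q)) _ t with nonzero-avoiding t
... | s , s≢0 , s≢t = suc s , leaf-dominates-other-leaf (suc (suc q)) s≢0 s≢t

proposition2p9 : (n : ℕ) → 0 < n → n ≢ 1 → n ≢ 3 →
    Σ (FinGraph n) (λ G → Connected G × TDCNumber≡ (Central G) n)
proposition2p9 zero          ()
proposition2p9 (suc zero)    _ n≢1 _   = contradiction refl n≢1
proposition2p9 (suc (suc p)) _ _   n≢3 =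
  star p , star-connected p ,
  central-star-TDCNumber p (leaves-dominated p (λ p≡1 → n≢3 (cong (2 +_) p≡1)))
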